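{- Let $\mathbf A$ be a finite hoop and let $F$ be a filter of $\mathbf A$, with least element $l$; let $\mathbf F$ denote the subhoop of $\mathbf A$ with universe $F$. For $X\in\mathbf A/F$ let $t_X$ denote the greatest element of the class $X$. Then the map $\psi\colon\mathbf A/F\to\mathbf F$, $\psi(X)=t_X\vee l$, is a product morphism, and $\mathbf A\cong\mathbf F\ltimes_\psi(\mathbf A/F)$.
   Context: A hoop is an algebra $\mathbf A=(A;\cdot,\rightarrow,1)$ of type $\langle 2,2,0\rangle$ such that $(A;\cdot,1)$ is a commutative monoid and the identities $x\rightarrow x=1$, $(x\cdot y)\rightarrow z=x\rightarrow(y\rightarrow z)$ and $x\cdot(x\rightarrow y)=y\cdot(y\rightarrow x)$ hold. The order is $x\leq y$ iff $x\rightarrow y=1$; infima exist ($x\wedge y=x\cdot(x\rightarrow y)$), and in a finite hoop suprema $\vee$ exist. A filter of $\mathbf A$ is a nonempty $F\subseteq A$ that is upward closed and closed under $\cdot$; it is a subuniverse of $\mathbf A$. It induces the congruence $\theta_F=\{(x,y)\mid (x\rightarrow y)\cdot(y\rightarrow x)\in F\}$, and $\mathbf A/F$ denotes the quotient hoop $\mathbf A/\theta_F$. A map $f\colon B\to A$ between hoops is a product morphism if $f(1)=1$ and $f(x)\cdot f(y)=f(x\cdot y)=f(x)\wedge f(y)=f(x\wedge y)$ for all $x,y\in B$. For such $f$, the $f$-product $\mathbf A\ltimes_f\mathbf B$ is the hoop with universe $\{(a,x)\in A\times B\mid a\leq f(x)\}$, constant $(1,1)$ and operations $(a,x)\cdot(b,y)=(a\cdot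 b,\,x\cdot y)$ and $(a,x)\rightarrow(b,y)=(f(x\rightarrow y)\wedge(a\rightarrow b),\,x\rightarrow y)$. -}

module Defs where

open import Level using (Level; _⊔_) renaming (suc to lsuc)
open import Algebra.Structures using (IsCommutativeMonoid)
open import Relation.Binary.Core using (Rel)
open import Relation.Unary using (Pred)
open import Relation.Binary.PropositionalEquality using (_≡_)
open import Data.Product using (Σ; ∃; _×_; _,_)
open import Data.Nat using (ℕ)
open import Data.Fin using (Fin)

-- Hoops (over a setoid equality _≈_, so that quotients can be
-- represented by changing the equality).

record Hoop (c ℓ : Level) : Set (lsuc (c ⊔ ℓ)) where
  infixl 7 _·_
  infixr 5 _⇒_
  infix 4 _≈_ _≤_
  infixl 6 _∧_
  field
    Carrier : Set c
    _≈_ : Rel Carrier ℓ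
    _·_ : Carrier → Carrier → Carrier
    _⇒_ : Carrier → Carrier → Carrier
    1# : Carrier
    isCommutativeMonoid : IsCommutativeMonoid _≈_ _·_ 1#
    ⇒-cong : ∀ {x y u v} → x ≈ y → u ≈ v → (x ⇒ u) ≈ (y ⇒ v)
    ⇒-refl : ∀ x → (x ⇒ x) ≈ 1#
    ⇒-curry : ∀ x y z → ((x · y) ⇒ z) ≈ (x ⇒ (y ⇒ z))
    divisibility : ∀ x y → (x · (x ⇒ y)) ≈ (y · (y ⇒ x))

  _≤_ : Rel Carrier ℓ
  x ≤ y = (x ⇒ y) ≈ 1#

  _∧_ : Carrier → Carrier → Carrier
  x ∧ y = x · (x ⇒ y)

Finite : ∀ {c ℓ} → Hoop c ℓ → Set (c ⊔ ℓ)
Finite A = Σ ℕ λ n → Σ (Fin n → Carrier) λ e →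
             (∀ i j → e i ≈ e j → i ≡ j) × (∀ x → Σ (Fin n) λ i → e i ≈ x)
  where open Hoop A

IsSup : ∀ {c ℓ} (A : Hoop c ℓ) → Hoop.Carrier A → Hoop.Carrier A → Hoop.Carrier A → Set (c ⊔ ℓ)
IsSup A a b s = a ≤ s × b ≤ s × (∀ u → a ≤ u → b ≤ u → s ≤ u)
  where open Hoop A

module _ {c ℓ p : Level} (A : Hoop c ℓ) where
  open Hoop A

  record IsFilter (F : Pred Carrier p) : Set (c ⊔ ℓ ⊔ p) where
    field
      nonempty : ∃ λ x → F x
      upward   : ∀ {x y} → x ≤ y → F x → F y
      ·-closed : ∀ {x y} → F x → F y → F (x · y)

  -- the congruence θ_F induced by F (this is the equality of A/F)
  θ : Pred Carrier p → Rel Carrier p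
  θ F x y = F ((x ⇒ y) · (y ⇒ x))

  IsLeast : Pred Carrier p → Carrier → Set (c ⊔ ℓ ⊔ p)
  IsLeast F l = F l × (∀ x → F x → l ≤ x)

  IsGreatestOfClass : Pred Carrier p → Carrier → Carrier → Set (c ⊔ ℓ ⊔ p)
  IsGreatestOfClass F x t = θ F t x × (∀ y → θ F y x → y ≤ t)

  -- f : A/F → F is a product morphism.  Elements of A/F are represented
  -- by elements of A (with equality θ F, operations those of A); the
  -- subhoop F has the operations and equality of A.
  record IsProductMorphism (F : Pred Carrier p) (f : Carrier → Carrier)
         : Set (c ⊔ ℓ ⊔ p) where
    field
      well-defined : ∀ {x y} → θ F x y → f x ≈ f y
      into         : ∀ x → F (f x)
      pres-1       : f 1# ≈ 1#
      ·-eq-·       : ∀ x y → (f x · f y) ≈ f (x · y)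
      ·-eq-∧       : ∀ x y → f (x · y) ≈ (f x ∧ f y)
      ∧-eq-∧       : ∀ x y → (f x ∧ f y) ≈ f (x ∧ y)

  -- The f-product F ⋉_f (A/F): pairs (a , X) with a ∈ F, X ∈ A/F,
  -- a ≤ f X; equality componentwise (≈ in F, θ F in A/F).
  Pair : Set c
  Pair = Carrier × Carrier

  module _ (F : Pred Carrier p) (f : Carrier → Carrier) where

    InProduct : Pair → Set (ℓ ⊔ p)
    InProduct (a , x) = F a × a ≤ f x

    _≈ₚ_ : Pair → Pair → Set (ℓ ⊔ p)
    (a , x) ≈ₚ (b , y) = a ≈ b × θ F x y

    1ₚ : Pair
    1ₚ = 1# , 1#

    _·ₚ_ : Pair → Pair → Pair
    (a , x) ·ₚ (b , y) = a · b , x · y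

    _⇒ₚ_ : Pair → Pair → Pair
    (a , x) ⇒ₚ (b , y) = (f (x ⇒ y) ∧ (a ⇒ b)) , (x ⇒ y)

    record IsoToProduct : Set (c ⊔ ℓ ⊔ p) where
      field
        h      : Carrier → Pair
        h-cong : ∀ {x y} → x ≈ y → h x ≈ₚ h y
        h-into : ∀ x → InProduct (h x)
        h-inj  : ∀ {x y} → h x ≈ₚ h y → x ≈ y
        h-surj : ∀ q → InProduct q → Σ Carrier λ x → h x ≈ₚ q
        h-1    : h 1# ≈ₚ 1ₚ
        h-·    : ∀ x y → h (x · y) ≈ₚ (h x ·ₚ h y)
        h-⇒    : ∀ x y → h (x ⇒ y) ≈ₚ (h x ⇒ₚ h y)

-- The least element l of F is idempotent, so x θ_F y holds iff l·x ≤ y and l·y ≤ x; hence the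
-- class of x has greatest element l ⇒ x and ψ x is the join (l ⇒ x) ∨ l. Joins with an
-- idempotent are multiplicative, (x ∨ l)(y ∨ l) = xy ∨ l, and ψ x is idempotent, which makes ψ
-- a product morphism. The isomorphism is x ↦ (x ∨ l, x/F), where x ∨ l = ψ x · ((l ⇒ x) ⇒ x):
-- it is injective because x ≤ y ∨ l together with l·x ≤ y forces x ≤ y, and (a, x/F) is the
-- image of a ∧ (l ⇒ x).
module Submission where

open import Defs
open import Level using (Level)
open import Relation.Unary using (Pred)
open import Data.Product using (_×_; _,_; proj₁; proj₂; Σ)
open import Algebra.Bundles using (CommutativeMonoid)
open import Relation.Binary.Bundles using (Poset)
import Algebra.Properties.CommutativeSemigroup as CommutativeSemigroupProperties
import Relation.Binary.Reasoning.PartialOrder as PartialOrderReasoning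
import Relation.Binary.Reasoning.Setoid as SetoidReasoning

module HoopProperties {c ℓ : Level} (A : Hoop c ℓ) where
  open Hoop A

  ·-commutativeMonoid : CommutativeMonoid c ℓ
  ·-commutativeMonoid = record { isCommutativeMonoid = isCommutativeMonoid }

  open CommutativeMonoid ·-commutativeMonoid public
    using ( refl; sym; trans; ∙-cong; ∙-congˡ; ∙-congʳ; assoc; comm; identityʳ
          ; setoid; commutativeSemigroup)
  open CommutativeSemigroupProperties commutativeSemigroup public using (interchange)
  module ≈-Reasoning = SetoidReasoning setoid

  ≤-reflexive : ∀ {x y} → x ≈ y → x ≤ y
  ≤-reflexive {y = y} x≈y = trans (⇒-cong x≈y refl) (⇒-refl y)

  ≤-refl : ∀ {x} → x ≤ x
  ≤-refl {x} = ⇒-refl x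

  ≤-antisym : ∀ {x y} → x ≤ y → y ≤ x → x ≈ y
  ≤-antisym {x} {y} x≤y y≤x = begin
    x               ≈⟨ identityʳ x ⟨
    x · 1#          ≈⟨ ∙-congˡ x≤y ⟨
    x · (x ⇒ y)     ≈⟨ divisibility x y ⟩
    y · (y ⇒ x)     ≈⟨ ∙-congˡ y≤x ⟩
    y · 1#          ≈⟨ identityʳ y ⟩
    y               ∎
    where open ≈-Reasoning

  ≤-respˡ-≈ : ∀ {x x′ y} → x ≈ x′ → x ≤ y → x′ ≤ y
  ≤-respˡ-≈ x≈x′ x≤y = trans (⇒-cong (sym x≈x′) refl) x≤y

  ≤-respʳ-≈ : ∀ {x y y′} → y ≈ y′ → x ≤ y → x ≤ y′
  ≤-respʳ-≈ y≈y′ x≤y = trans (⇒-cong refl (sym y≈y′)) x≤y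

  curry-≤ : ∀ {x y z} → x · y ≤ z → x ≤ y ⇒ z
  curry-≤ {x} {y} {z} = trans (sym (⇒-curry x y z))

  uncurry-≤ : ∀ {x y z} → x ≤ y ⇒ z → x · y ≤ z
  uncurry-≤ {x} {y} {z} = trans (⇒-curry x y z)

  ⇒-eval : ∀ {x y} → (x ⇒ y) · x ≤ y
  ⇒-eval = uncurry-≤ ≤-refl

  ⇒-identityˡ : ∀ x → 1# ⇒ x ≈ x
  ⇒-identityˡ x = ≤-antisym (≤-respˡ-≈ (identityʳ _) ⇒-eval)
                            (curry-≤ (≤-reflexive (identityʳ x)))

  x≤1 : ∀ {x} → x ≤ 1#
  x≤1 {x} = begin
    x ⇒ 1#                ≈⟨ ⇒-cong x·[x⇒1]≈x refl ⟨
    (x · (x ⇒ 1#)) ⇒ 1#   ≈⟨ ⇒-cong (comm x _) refl ⟩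
    ((x ⇒ 1#) · x) ⇒ 1#   ≈⟨ ⇒-curry _ x 1# ⟩
    (x ⇒ 1#) ⇒ (x ⇒ 1#)   ≈⟨ ⇒-refl _ ⟩
    1#                    ∎
    where
    open ≈-Reasoning
    x·[x⇒1]≈x : x · (x ⇒ 1#) ≈ x
    x·[x⇒1]≈x = trans (divisibility x 1#) (trans (comm 1# _) (trans (identityʳ _) (⇒-identityˡ x)))

  ≤⇒∧≈ : ∀ {x y} → x ≤ y → y ∧ x ≈ x
  ≤⇒∧≈ {x} {y} x≤y =
    trans (sym (divisibility x y)) (trans (∙-congˡ x≤y) (identityʳ x))

  ≤-trans : ∀ {x y z} → x ≤ y → y ≤ z → x ≤ z
  ≤-trans {x} {y} x≤y y≤z =
    ≤-respˡ-≈ (trans (comm _ y) (≤⇒∧≈ x≤y)) (uncurry-≤ (≤-respʳ-≈ (sym y≤z) x≤1))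

  ≤-poset : Poset c ℓ ℓ
  ≤-poset = record
    { _≈_ = _≈_
    ; _≤_ = _≤_
    ; isPartialOrder = record
      { isPreorder = record
        { isEquivalence = CommutativeMonoid.isEquivalence ·-commutativeMonoid
        ; reflexive = ≤-reflexive
        ; trans = ≤-trans
        }
      ; antisym = ≤-antisym
      }
    }

  module ≤-Reasoning = PartialOrderReasoning ≤-poset

  open ≤-Reasoning

  x·y≤y : ∀ {x y} → x · y ≤ y
  x·y≤y {y = y} = uncurry-≤ (≤-respʳ-≈ (sym (⇒-refl y)) x≤1)

  x·y≤x : ∀ {x y} → x · y ≤ x
  x·y≤x {x} {y} = ≤-respˡ-≈ (comm y x) x·y≤y

  x≤y⇒x : ∀ {x y} → x ≤ y ⇒ x
  x≤y⇒x = curry-≤ x·y≤x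

  x∧y≤x : ∀ {x y} → x ∧ y ≤ x
  x∧y≤x = x·y≤x

  x∧y≤y : ∀ {x y} → x ∧ y ≤ y
  x∧y≤y {x} = ≤-respˡ-≈ (comm _ x) ⇒-eval

  ∧-comm : ∀ x y → x ∧ y ≈ y ∧ x
  ∧-comm = divisibility

  ·-monoˡ-≤ : ∀ {x y z} → x ≤ y → x · z ≤ y · z
  ·-monoˡ-≤ x≤y = uncurry-≤ (≤-trans x≤y (curry-≤ ≤-refl))

  ·-monoʳ-≤ : ∀ {x y z} → x ≤ y → z · x ≤ z · y
  ·-monoʳ-≤ {x} {y} {z} x≤y = ≤-respˡ-≈ (comm x z) (≤-respʳ-≈ (comm y z) (·-monoˡ-≤ x≤y))

  ·-mono-≤ : ∀ {x y u v} → x ≤ y → u ≤ v → x · u ≤ y · v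
  ·-mono-≤ x≤y u≤v = ≤-trans (·-monoˡ-≤ x≤y) (·-monoʳ-≤ u≤v)

  ⇒-monoʳ-≤ : ∀ {x y z} → x ≤ y → z ⇒ x ≤ z ⇒ y
  ⇒-monoʳ-≤ x≤y = curry-≤ (≤-trans ⇒-eval x≤y)

  ⇒-antimonoˡ-≤ : ∀ {x y z} → x ≤ y → y ⇒ z ≤ x ⇒ z
  ⇒-antimonoˡ-≤ x≤y = curry-≤ (≤-trans (·-monoʳ-≤ x≤y) ⇒-eval)

  ∧-greatest : ∀ {x y z} → z ≤ x → z ≤ y → z ≤ x ∧ y
  ∧-greatest z≤x z≤y = ≤-respˡ-≈ (≤⇒∧≈ z≤x) (·-monoʳ-≤ (⇒-monoʳ-≤ z≤y))

  x·y≤x∧y : ∀ {x y} → x · y ≤ x ∧ y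
  x·y≤x∧y = ∧-greatest x·y≤x x·y≤y

  idempotent⇒∧≤· : ∀ {a y} → a · a ≈ a → a ∧ y ≤ a · y
  idempotent⇒∧≤· {a} {y} a·a≈a = begin
    a · (a ⇒ y)         ≈⟨ ∙-congʳ a·a≈a ⟨
    (a · a) · (a ⇒ y)   ≈⟨ assoc a a _ ⟩
    a · (a ∧ y)         ≤⟨ ·-monoʳ-≤ x∧y≤y ⟩
    a · y               ∎

  sup-·-least : ∀ {a b s c u} → IsSup A a b s → a · c ≤ u → b · c ≤ u → s · c ≤ u
  sup-·-least (_ , _ , least) a·c≤u b·c≤u = uncurry-≤ (least _ (curry-≤ a·c≤u) (curry-≤ b·c≤u))

  sup-mono : ∀ {a a′ b s s′} → a ≤ a′ → IsSup A a b s → IsSup A a′ b s′ → s ≤ s′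
  sup-mono a≤a′ (_ , _ , least) (a′≤s′ , b≤s′ , _) = least _ (≤-trans a≤a′ a′≤s′) b≤s′

  sup-congˡ : ∀ {a a′ b s s′} → a ≈ a′ → IsSup A a b s → IsSup A a′ b s′ → s ≈ s′
  sup-congˡ a≈a′ sup sup′ =
    ≤-antisym (sup-mono (≤-reflexive a≈a′) sup sup′) (sup-mono (≤-reflexive (sym a≈a′)) sup′ sup)

  IsSup-respˡ : ∀ {a a′ b s} → a ≈ a′ → IsSup A a b s → IsSup A a′ b s
  IsSup-respˡ a≈a′ (a≤s , b≤s , least) =
    ≤-respˡ-≈ a≈a′ a≤s , b≤s , λ u a′≤u → least u (≤-respˡ-≈ (sym a≈a′) a′≤u)

  ≤-sup-cases : ∀ {a b s w u} → IsSup A a b s → w ≤ s → a ∧ w ≤ u → b ∧ w ≤ u → w ≤ u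
  ≤-sup-cases {a} {b} {s} {w} {u} sup@(a≤s , b≤s , _) w≤s a∧w≤u b∧w≤u = begin
    w             ≈⟨ ≤⇒∧≈ w≤s ⟨
    s · (s ⇒ w)   ≤⟨ sup-·-least sup (≤-trans (·-monoʳ-≤ (⇒-antimonoˡ-≤ a≤s)) a∧w≤u)
                                     (≤-trans (·-monoʳ-≤ (⇒-antimonoˡ-≤ b≤s)) b∧w≤u) ⟩
    u             ∎

  IsSup-descend : ∀ {x y z s} → IsSup A y z s → z · z ≈ z → x ≤ y → z ≤ y ⇒ x →
                  IsSup A x z (s · (y ⇒ x))
  IsSup-descend {x} {y} {z} {s} sup@(y≤s , z≤s , _) z·z≈z x≤y z≤y⇒x =
    x≤s·[y⇒x] , z≤s·[y⇒x] , λ u x≤u z≤u →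
      sup-·-least sup (≤-trans x∧y≤y x≤u) (≤-trans x·y≤x z≤u)
    where
    x≤s·[y⇒x] : x ≤ s · (y ⇒ x)
    x≤s·[y⇒x] = ≤-respˡ-≈ (≤⇒∧≈ x≤y) (·-monoˡ-≤ y≤s)
    z≤s·[y⇒x] : z ≤ s · (y ⇒ x)
    z≤s·[y⇒x] = ≤-respˡ-≈ z·z≈z (·-mono-≤ z≤s z≤y⇒x)

  sup-absorb : ∀ {x z s q} → IsSup A x z s → z · z ≈ z → q ≤ s → z · q ≤ x → q ≤ x
  sup-absorb sup z·z≈z q≤s z·q≤x =
    ≤-sup-cases sup q≤s x∧y≤x (≤-trans (idempotent⇒∧≤· z·z≈z) z·q≤x)

  ·-distrib-sup : ∀ {x y z s₁ s₂ s} → IsSup A x z s₁ → IsSup A y z s₂ → IsSup A (x · y) z s →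
                  z · z ≈ z → s₁ · s₂ ≈ s
  ·-distrib-sup {x} {y} {z} {s₁} {s₂} {s} sup₁@(x≤s₁ , z≤s₁ , _) sup₂@(y≤s₂ , z≤s₂ , _)
                (x·y≤s , z≤s , least) z·z≈z =
    ≤-antisym (sup-·-least sup₁ x·s₂≤s (≤-trans x·y≤x z≤s))
              (least _ (·-mono-≤ x≤s₁ y≤s₂) (≤-respˡ-≈ z·z≈z (·-mono-≤ z≤s₁ z≤s₂)))
    where
    x·s₂≤s : x · s₂ ≤ s
    x·s₂≤s = ≤-respˡ-≈ (comm s₂ x)
      (sup-·-least sup₂ (≤-respˡ-≈ (comm x y) x·y≤s) (≤-trans x·y≤x z≤s))

  greatestOfClass-unique : ∀ {p} {F : Pred Carrier p} {x t t′} →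
                           IsGreatestOfClass A F x t → IsGreatestOfClass A F x t′ → t ≈ t′
  greatestOfClass-unique (t∼x , greatest) (t′∼x , greatest′) =
    ≤-antisym (greatest′ _ t∼x) (greatest _ t′∼x)

module LeastElementOfFilter {c ℓ p : Level} (A : Hoop c ℓ) {F : Pred (Hoop.Carrier A) p}
  (isFilter : IsFilter A F) {l : Hoop.Carrier A} (least : IsLeast A F l) where
  open Hoop A
  open HoopProperties A
  open IsFilter isFilter
  open ≤-Reasoning

  ∈⇒l≤ : ∀ {x} → F x → l ≤ x
  ∈⇒l≤ = proj₂ least _

  l≤⇒∈ : ∀ {x} → l ≤ x → F x
  l≤⇒∈ l≤x = upward l≤x (proj₁ least)

  l·l≈l : l · l ≈ l
  l·l≈l = ≤-antisym x·y≤x (∈⇒l≤ (·-closed (proj₁ least) (proj₁ least)))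

  θ-intro : ∀ {x y} → l · x ≤ y → l · y ≤ x → θ A F x y
  θ-intro l·x≤y l·y≤x = ·-closed (l≤⇒∈ (curry-≤ l·x≤y)) (l≤⇒∈ (curry-≤ l·y≤x))

  θ-elimˡ : ∀ {x y} → θ A F x y → l · x ≤ y
  θ-elimˡ x∼y = uncurry-≤ (∈⇒l≤ (upward x·y≤x x∼y))

  θ-elimʳ : ∀ {x y} → θ A F x y → l · y ≤ x
  θ-elimʳ x∼y = uncurry-≤ (∈⇒l≤ (upward x·y≤y x∼y))

  ≈⇒θ : ∀ {x y} → x ≈ y → θ A F x y
  ≈⇒θ x≈y = θ-intro (≤-trans x·y≤y (≤-reflexive x≈y)) (≤-trans x·y≤y (≤-reflexive (sym x≈y)))

  l⇒-greatestOfClass : ∀ x → IsGreatestOfClass A F x (l ⇒ x)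
  l⇒-greatestOfClass x =
    θ-intro x∧y≤y (curry-≤ (≤-trans x·y≤x x·y≤y)) ,
    λ y y∼x → curry-≤ (≤-respˡ-≈ (comm l y) (θ-elimˡ y∼x))

  l⇒-idem : ∀ {x} → l ⇒ (l ⇒ x) ≈ l ⇒ x
  l⇒-idem {x} = trans (sym (⇒-curry l l x)) (⇒-cong l·l≈l refl)

  l⇒-mono : ∀ {x y} → l · x ≤ y → l ⇒ x ≤ l ⇒ y
  l⇒-mono {x} {y} l·x≤y = begin
    l ⇒ x           ≤⟨ ⇒-monoʳ-≤ (curry-≤ (≤-respˡ-≈ (comm l x) l·x≤y)) ⟩
    l ⇒ (l ⇒ y)     ≈⟨ l⇒-idem ⟩
    l ⇒ y           ∎

  l⇒-· : ∀ {x y} → (l ⇒ x) · (l ⇒ y) ≤ l ⇒ (x · y)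
  l⇒-· {x} {y} = curry-≤ (begin
    ((l ⇒ x) · (l ⇒ y)) · l         ≈⟨ ∙-congˡ l·l≈l ⟨
    ((l ⇒ x) · (l ⇒ y)) · (l · l)   ≈⟨ interchange _ _ l l ⟩
    ((l ⇒ x) · l) · ((l ⇒ y) · l)   ≤⟨ ·-mono-≤ ⇒-eval ⇒-eval ⟩
    x · y                           ∎)

module ProductDecomposition {c ℓ p : Level} (A : Hoop c ℓ) {F : Pred (Hoop.Carrier A) p}
  (isFilter : IsFilter A F) {l : Hoop.Carrier A} (least : IsLeast A F l)
  {t : Hoop.Carrier A → Hoop.Carrier A} (t-greatest : ∀ x → IsGreatestOfClass A F x (t x))
  {ψ : Hoop.Carrier A → Hoop.Carrier A} (ψ-sup : ∀ x → IsSup A (t x) l (ψ x)) where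
  open Hoop A
  open HoopProperties A
  open LeastElementOfFilter A isFilter least
  open ≤-Reasoning

  ψ-isSup : ∀ x → IsSup A (l ⇒ x) l (ψ x)
  ψ-isSup x = IsSup-respˡ (greatestOfClass-unique {F = F} (t-greatest x) (l⇒-greatestOfClass x)) (ψ-sup x)

  -- The join x ∨ l, which IsSup-descend extracts from ψ x = (l ⇒ x) ∨ l.
  _∨l : Carrier → Carrier
  x ∨l = ψ x · ((l ⇒ x) ⇒ x)

  ∨l-isSup : ∀ x → IsSup A x l (x ∨l)
  ∨l-isSup x = IsSup-descend (ψ-isSup x) l·l≈l x≤y⇒x (curry-≤ x∧y≤y)

  x≤x∨l : ∀ {x} → x ≤ x ∨l
  x≤x∨l {x} = proj₁ (∨l-isSup x)

  l≤x∨l : ∀ {x} → l ≤ x ∨l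
  l≤x∨l {x} = proj₁ (proj₂ (∨l-isSup x))

  ∨l-least : ∀ {x u} → x ≤ u → l ≤ u → x ∨l ≤ u
  ∨l-least {x} {u} = proj₂ (proj₂ (∨l-isSup x)) u

  ∨l-mono : ∀ {x y} → x ≤ y → x ∨l ≤ y ∨l
  ∨l-mono {x} {y} x≤y = sup-mono x≤y (∨l-isSup x) (∨l-isSup y)

  ∨l-· : ∀ x y → (x · y) ∨l ≈ x ∨l · y ∨l
  ∨l-· x y = sym (·-distrib-sup (∨l-isSup x) (∨l-isSup y) (∨l-isSup (x · y)) l·l≈l)

  ∨l≤ψ : ∀ {x} → x ∨l ≤ ψ x
  ∨l≤ψ {x} = sup-mono x≤y⇒x (∨l-isSup x) (ψ-isSup x)

  ψ≈[l⇒x]∨l : ∀ {x} → ψ x ≈ (l ⇒ x) ∨l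
  ψ≈[l⇒x]∨l {x} = sup-congˡ refl (ψ-isSup x) (∨l-isSup (l ⇒ x))

  l≤ψ : ∀ {x} → l ≤ ψ x
  l≤ψ {x} = proj₁ (proj₂ (ψ-isSup x))

  ψ-mono : ∀ {x y} → l · x ≤ y → ψ x ≤ ψ y
  ψ-mono {x} {y} l·x≤y = sup-mono (l⇒-mono l·x≤y) (ψ-isSup x) (ψ-isSup y)

  ψ-mono-≤ : ∀ {x y} → x ≤ y → ψ x ≤ ψ y
  ψ-mono-≤ x≤y = ψ-mono (≤-trans x·y≤y x≤y)

  ψ-cong : ∀ {x y} → θ A F x y → ψ x ≈ ψ y
  ψ-cong x∼y = ≤-antisym (ψ-mono (θ-elimˡ x∼y)) (ψ-mono (θ-elimʳ x∼y))

  ψ-idempotent : ∀ x → ψ x · ψ x ≈ ψ x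
  ψ-idempotent x = ≤-antisym x·y≤x
    (proj₂ (proj₂ (ψ-isSup x)) _ l⇒x≤ψ·ψ (≤-respˡ-≈ l·l≈l (·-mono-≤ l≤ψ l≤ψ)))
    where
    l⇒x≤ψ : l ⇒ x ≤ ψ x
    l⇒x≤ψ = proj₁ (ψ-isSup x)
    l⇒x≤ψ·ψ : l ⇒ x ≤ ψ x · ψ x
    l⇒x≤ψ·ψ = begin
      l ⇒ x                   ≈⟨ ≤⇒∧≈ l⇒x≤ψ ⟨
      ψ x · (ψ x ⇒ (l ⇒ x))   ≤⟨ ·-monoʳ-≤ (⇒-antimonoˡ-≤ l≤ψ) ⟩
      ψ x · (l ⇒ (l ⇒ x))     ≈⟨ ∙-congˡ l⇒-idem ⟩
      ψ x · (l ⇒ x)           ≤⟨ ·-monoʳ-≤ l⇒x≤ψ ⟩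
      ψ x · ψ x               ∎

  ψ-·-≤ : ∀ {x y} → ψ x · ψ y ≤ ψ (x · y)
  ψ-·-≤ {x} {y} = begin
    ψ x · ψ y                      ≈⟨ ∙-cong ψ≈[l⇒x]∨l ψ≈[l⇒x]∨l ⟩
    (l ⇒ x) ∨l · (l ⇒ y) ∨l        ≈⟨ ∨l-· (l ⇒ x) (l ⇒ y) ⟨
    ((l ⇒ x) · (l ⇒ y)) ∨l         ≤⟨ ∨l-mono l⇒-· ⟩
    (l ⇒ (x · y)) ∨l               ≈⟨ ψ≈[l⇒x]∨l ⟨
    ψ (x · y)                      ∎

  ψ-≤-∧ : ∀ {x y} → ψ (x · y) ≤ ψ x ∧ ψ y
  ψ-≤-∧ = ∧-greatest (ψ-mono-≤ x·y≤x) (ψ-mono-≤ x·y≤y)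

  ψ-∧-≤-· : ∀ {x y} → ψ x ∧ ψ y ≤ ψ x · ψ y
  ψ-∧-≤-· {x} = idempotent⇒∧≤· (ψ-idempotent x)

  ψ-isProductMorphism : IsProductMorphism A F ψ
  ψ-isProductMorphism = record
    { well-defined = ψ-cong
    ; into         = λ _ → l≤⇒∈ l≤ψ
    ; pres-1       = ≤-antisym x≤1 (≤-trans x≤y⇒x (proj₁ (ψ-isSup 1#)))
    ; ·-eq-·       = λ _ _ → ≤-antisym ψ-·-≤ (≤-trans ψ-≤-∧ ψ-∧-≤-·)
    ; ·-eq-∧       = λ _ _ → ≤-antisym ψ-≤-∧ (≤-trans ψ-∧-≤-· ψ-·-≤)
    ; ∧-eq-∧       = λ _ _ → ≤-antisym (≤-trans (≤-trans ψ-∧-≤-· ψ-·-≤) (ψ-mono-≤ x·y≤x∧y))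
                                       (∧-greatest (ψ-mono-≤ x∧y≤x) (ψ-mono-≤ x∧y≤y))
    }

  ∨l-injective : ∀ {x y} → x ∨l ≈ y ∨l → θ A F x y → x ≈ y
  ∨l-injective {x} {y} x∨l≈y∨l x∼y = ≤-antisym
    (sup-absorb (∨l-isSup y) l·l≈l (≤-trans x≤x∨l (≤-reflexive x∨l≈y∨l)) (θ-elimˡ x∼y))
    (sup-absorb (∨l-isSup x) l·l≈l (≤-trans x≤x∨l (≤-reflexive (sym x∨l≈y∨l))) (θ-elimʳ x∼y))

  ∨l-surjective : ∀ {a x} → F a → a ≤ ψ x → Σ Carrier λ y → y ∨l ≈ a × θ A F y x
  ∨l-surjective {a} {x} a∈F a≤ψ = y , ≤-antisym (∨l-least x∧y≤x (∈⇒l≤ a∈F)) a≤y∨l ,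
    θ-intro (≤-trans (·-monoʳ-≤ x∧y≤y) x∧y≤y)
            (∧-greatest (≤-trans x·y≤x (∈⇒l≤ a∈F)) (≤-trans x·y≤y x≤y⇒x))
    where
    y = a ∧ (l ⇒ x)
    a≤y∨l : a ≤ y ∨l
    a≤y∨l = ≤-sup-cases (ψ-isSup x) a≤ψ (≤-trans (≤-reflexive (∧-comm (l ⇒ x) a)) x≤x∨l)
                                         (≤-trans x∧y≤x l≤x∨l)

  ∨l-⇒ : ∀ x y → (x ⇒ y) ∨l ≈ ψ (x ⇒ y) ∧ (x ∨l ⇒ y ∨l)
  ∨l-⇒ x y = ≤-antisym (∧-greatest ∨l≤ψ (curry-≤ z∨l·x∨l≤y∨l))
                       (≤-sup-cases (ψ-isSup z) x∧y≤x (≤-trans n≤z x≤x∨l) (≤-trans x∧y≤x l≤x∨l))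
    where
    z = x ⇒ y
    z∨l·x∨l≤y∨l : z ∨l · x ∨l ≤ y ∨l
    z∨l·x∨l≤y∨l = ≤-trans (≤-reflexive (sym (∨l-· z x))) (∨l-mono ⇒-eval)
    n = (l ⇒ z) ∧ (ψ z ∧ (x ∨l ⇒ y ∨l))
    n·x≤y∨l : n · x ≤ y ∨l
    n·x≤y∨l = ≤-trans (·-mono-≤ (≤-trans x∧y≤y x∧y≤y) x≤x∨l) ⇒-eval
    l·[n·x]≤y : l · (n · x) ≤ y
    l·[n·x]≤y = begin
      l · (n · x)   ≈⟨ assoc l n x ⟨
      (l · n) · x   ≤⟨ ·-monoˡ-≤ (≤-trans (·-monoʳ-≤ x∧y≤x) x∧y≤y) ⟩
      z · x         ≤⟨ ⇒-eval ⟩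
      y             ∎
    n≤z : n ≤ z
    n≤z = curry-≤ (sup-absorb (∨l-isSup y) l·l≈l n·x≤y∨l l·[n·x]≤y)

  ∨l-isoToProduct : IsoToProduct A F ψ
  ∨l-isoToProduct = record
    { h      = λ x → x ∨l , x
    ; h-cong = λ x≈y → sup-congˡ x≈y (∨l-isSup _) (∨l-isSup _) , ≈⇒θ x≈y
    ; h-into = λ _ → l≤⇒∈ l≤x∨l , ∨l≤ψ
    ; h-inj  = λ (x∨l≈y∨l , x∼y) → ∨l-injective x∨l≈y∨l x∼y
    ; h-surj = λ _ (a∈F , a≤ψ) → ∨l-surjective a∈F a≤ψ
    ; h-1    = ≤-antisym x≤1 x≤x∨l , ≈⇒θ refl
    ; h-·    = λ x y → ∨l-· x y , ≈⇒θ refl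
    ; h-⇒    = λ x y → ∨l-⇒ x y , ≈⇒θ refl
    }

-- Finiteness of A is what makes the greatest elements t x and the joins ψ x exist; since
-- they are supplied as hypotheses, the argument itself does not use it.
theorem14 : {c ℓ p : Level} (A : Hoop c ℓ) → Finite A →
            (F : Pred (Hoop.Carrier A) p) → IsFilter A F →
            (l : Hoop.Carrier A) → IsLeast A F l →
            (t : Hoop.Carrier A → Hoop.Carrier A) →
            (∀ x → IsGreatestOfClass A F x (t x)) →
            (ψ : Hoop.Carrier A → Hoop.Carrier A) →
            (∀ x → IsSup A (t x) l (ψ x)) →
            IsProductMorphism A F ψ × IsoToProduct A F ψ
theorem14 A _ F isFilter l least t t-greatest ψ ψ-sup =
  ψ-isProductMorphism , ∨l-isoToProduct
  where open ProductDecomposition A isFilter least t-greatest ψ-sup
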